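{- In every $\lambda_{imp}$-model $\mathcal{D}$ the following equations are true (an equation $M=N$ between computations is true if $[\![M]\!]^{T}e=[\![N]\!]^{T}e$ for every environment $e$): (1) $[V]\star(\lambda x.M)=M[V/x]$; (2) $M\star\lambda x.[x]=M$; (3) $(L\star\lambda x.M)\star\lambda y.N=L\star\lambda x.(M\star\lambda y.N)$, provided $x\notin FV(\lambda y.N)$; (4) $\mathit{get}_\ell(\lambda x.M)\star W=\mathit{get}_\ell(\lambda x.(M\star W))$, provided $x\notin FV(W)$; (5) $\mathit{set}_\ell(V,M)\star W=\mathit{set}_\ell(V,M\star W)$.
   Context: Syntax. Fix a countably infinite set $\mathbf{L}$ of locations and a countable set $\mathrm{Var}$ of variables. Values $V,W ::= x \mid \lambda x.M$; computations $L,M,N ::= [V] \mid M \star V \mid \mathit{get}_\ell(\lambda x.M) \mid \mathit{set}_\ell(V,M)$ ($\ell\in\mathbf{L}$); $x$ is bound in $\lambda x.M$ and $\mathit{get}_\ell(\lambda x.M)$; $FV$ denotes free variables; $M[V/x]$ is capture-avoiding substitution. Models. For a domain $X$, $X_\bot$ is its lifting (new least element $\bot$). Given a domain $D$: $S=(D_\bot)^{\mathbf{L}}$ (pointwise order), $C=(D\times S)_\bot$, $TD=[S\to C]$ (continuous maps); $\mathrm{unit}(d)=\lambda\varsigma.(d,\varsigma)$; for $c\in TD$ and $f:D\to TD$, $(c\star f)(\varsigma)=f(d)(\varsigma')$ if $c(\varsigma)=(d,\varsigma')\ne\bot$ and $\bot$ if $c(\varsigma)=\bot$. $\varsigma[\ell\mapsto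 d]$ is $\varsigma$ updated at $\ell$. Environments are maps $e:\mathrm{Var}\to D$. A $\lambda_{imp}$-model is a domain $D$ with mutually inverse continuous $\Phi:D\to[D\to TD]$, $\Psi:[D\to TD]\to D$, and interpretations $[\![V]\!]^De\in D$, $[\![M]\!]^Te\in TD$ satisfying: $[\![x]\!]^De=e(x)$; $[\![\lambda x.M]\!]^De=\Psi(\lambda d\in D.\,[\![M]\!]^Te[x\mapsto d])$; $[\![[V]]\!]^Te=\mathrm{unit}([\![V]\!]^De)$; $[\![M\star V]\!]^Te=([\![M]\!]^Te)\star\Phi([\![V]\!]^De)$; $[\![\mathit{get}_\ell(\lambda x.M)]\!]^Te\,\varsigma=\Phi([\![\lambda x.M]\!]^De)(\varsigma(\ell))(\varsigma)$; $[\![\mathit{set}_\ell(V,M)]\!]^Te\,\varsigma=[\![M]\!]^Te\,(\varsigma[\ell\mapsto[\![V]\!]^De])$. -}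

module Defs where

open import Data.Nat using (ℕ; zero; suc; _⊔_; _≟_; _≡ᵇ_)
open import Data.Bool using (if_then_else_)
open import Data.List using (List; []; _∷_; _++_; filter; foldr; concatMap)
open import Data.List.Membership.Propositional using (_∈_)
open import Data.Maybe using (Maybe; just; nothing)
open import Data.Product using (Σ; _×_; _,_; proj₁; proj₂)
open import Data.Unit using (⊤)
open import Data.Empty using (⊥)
open import Relation.Nullary using (¬_; ¬?)
open import Relation.Binary.PropositionalEquality using (_≡_)

Loc : Set
Loc = ℕ

Var : Set
Var = ℕ

mutual
  data Val : Set where
    var : Var → Val
    lam : Var → Comp → Val

  data Comp : Set where
    ret : Val → Comp
    _⋆_ : Comp → Val → Comp
    get : Loc → Var → Comp → Comp    -- get_ℓ(λx.M)   (x bound in M)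
    set : Loc → Val → Comp → Comp

infixl 5 _⋆_

remove : Var → List Var → List Var
remove x = filter (λ y → ¬? (y ≟ x))

mutual
  fvV : Val → List Var
  fvV (var x)   = x ∷ []
  fvV (lam x M) = remove x (fvC M)

  fvC : Comp → List Var
  fvC (ret V)     = fvV V
  fvC (M ⋆ V)     = fvC M ++ fvV V
  fvC (get ℓ x M) = remove x (fvC M)
  fvC (set ℓ V M) = fvV V ++ fvC M

-- capture-avoiding (simultaneous) substitution, renaming bound variables
-- to a fresh name (Stoughton style)
Sub : Set
Sub = Var → Val

extend : Sub → Var → Val → Sub
extend σ x V y = if y ≡ᵇ x then V else σ y

-- a variable not free in σ z for any z in xs
fresh : Sub → List Var → Var
fresh σ xs = suc (foldr _⊔_ 0 (concatMap (λ z → fvV (σ z)) xs))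

mutual
  substV : Sub → Val → Val
  substV σ (var x)   = σ x
  substV σ (lam x M) =
    let y = fresh σ (fvV (lam x M)) in lam y (substC (extend σ x (var y)) M)

  substC : Sub → Comp → Comp
  substC σ (ret V)     = ret (substV σ V)
  substC σ (M ⋆ V)     = substC σ M ⋆ substV σ V
  substC σ (get ℓ x M) =
    let y = fresh σ (fvC (get ℓ x M)) in get ℓ y (substC (extend σ x (var y)) M)
  substC σ (set ℓ V M) = set ℓ (substV σ V) (substC σ M)

_[_/_] : Comp → Val → Var → Comp
M [ V / x ] = substC (extend var x V) M

Rel : Set → Set₁
Rel A = A → A → Set

Chain : {A : Set} → Rel A → (ℕ → A) → Set
Chain _⊑_ c = ∀ n → c n ⊑ c (suc n)

IsLub : {A : Set} → Rel A → (ℕ → A) → A → Set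
IsLub _⊑_ c x = (∀ n → c n ⊑ x) × (∀ y → (∀ n → c n ⊑ y) → x ⊑ y)

IsContinuous : {A B : Set} → Rel A → Rel B → (A → B) → Set
IsContinuous {A} _⊑₁_ _⊑₂_ f =
  (∀ {a b} → a ⊑₁ b → f a ⊑₂ f b) ×
  (∀ (c : ℕ → A) → Chain _⊑₁_ c → ∀ x → IsLub _⊑₁_ c x →
     IsLub _⊑₂_ (λ n → f (c n)) (f x))

-- lifting X_⊥ = Maybe X, with nothing = ⊥
data LiftR {A : Set} (_⊑_ : Rel A) : Rel (Maybe A) where
  ⊥≤ : ∀ {y} → LiftR _⊑_ nothing y
  up≤ : ∀ {a b} → a ⊑ b → LiftR _⊑_ (just a) (just b)

ProdR : {A B : Set} → Rel A → Rel B → Rel (A × B)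
ProdR _⊑₁_ _⊑₂_ p q = (proj₁ p ⊑₁ proj₁ q) × (proj₂ p ⊑₂ proj₂ q)

PointR : {I A : Set} → Rel A → Rel (I → A)
PointR _⊑_ f g = ∀ i → f i ⊑ g i

record Domain : Set₁ where
  field
    Carrier : Set
    _⊑_     : Rel Carrier
    ⊑-refl  : ∀ {x} → x ⊑ x
    ⊑-trans : ∀ {x y z} → x ⊑ y → y ⊑ z → x ⊑ z
    ⊑-antisym : ∀ {x y} → x ⊑ y → y ⊑ x → x ≡ y
    lub     : (c : ℕ → Carrier) → Chain _⊑_ c → Σ Carrier (IsLub _⊑_ c)

module _ (D : Domain) where
  open Domain D

  St : Set
  St = Loc → Maybe Carrier

  _⊑S_ : Rel St
  _⊑S_ = PointR (LiftR _⊑_)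

  Cst : Set
  Cst = Maybe (Carrier × St)

  _⊑C_ : Rel Cst
  _⊑C_ = LiftR (ProdR _⊑_ _⊑S_)

  -- extensional equality on C (states are functions)
  _≈C_ : Cst → Cst → Set
  nothing ≈C nothing = ⊤
  nothing ≈C just _ = ⊥
  just _ ≈C nothing = ⊥
  just (d , s) ≈C just (d' , s') = (d ≡ d') × (∀ ℓ → s ℓ ≡ s' ℓ)

  record TD : Set where
    constructor mkT
    field
      fun  : St → Cst
      cont : IsContinuous _⊑S_ _⊑C_ fun
  open TD public

  _⊑T_ : Rel TD
  f ⊑T g = PointR _⊑C_ (fun f) (fun g)

  record DT : Set where
    constructor mkDT
    field
      app  : Carrier → TD
      dcont : IsContinuous _⊑_ _⊑T_ app
  open DT public

  _⊑DT_ : Rel DT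
  f ⊑DT g = PointR _⊑T_ (app f) (app g)

  update : St → Loc → Maybe Carrier → St
  update ς ℓ v ℓ' = if ℓ' ≡ᵇ ℓ then v else ς ℓ'

  -- underlying function of c ⋆ f, evaluated at a given outcome c(ς)
  bindC : Cst → DT → Cst
  bindC nothing f = nothing
  bindC (just (d , ς')) f = fun (app f d) ς'

  appLift : DT → Maybe Carrier → St → Cst
  appLift f nothing ς = nothing
  appLift f (just d) ς = fun (app f d) ς

  Env : Set
  Env = Var → Carrier

  _[_↦_]e : Env → Var → Carrier → Env
  (e [ x ↦ d ]e) y = if y ≡ᵇ x then d else e y

  record Model : Set₁ where
    field
      Φ : Carrier → DT
      Ψ : DT → Carrier
      Φ-cont : IsContinuous _⊑_ _⊑DT_ Φ
      Ψ-cont : IsContinuous _⊑DT_ _⊑_ Ψ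
      ΨΦ : ∀ d → Ψ (Φ d) ≡ d
      ΦΨ : ∀ f d ς → fun (app (Φ (Ψ f)) d) ς ≈C fun (app f d) ς
      ⟦_⟧V : Val → Env → Carrier
      ⟦_⟧T : Comp → Env → TD
      lam-cont : ∀ x M e → IsContinuous _⊑_ _⊑T_ (λ d → ⟦ M ⟧T (e [ x ↦ d ]e))
      ⟦var⟧ : ∀ x e → ⟦ var x ⟧V e ≡ e x
      ⟦lam⟧ : ∀ x M e →
        ⟦ lam x M ⟧V e ≡ Ψ (mkDT (λ d → ⟦ M ⟧T (e [ x ↦ d ]e)) (lam-cont x M e))
      ⟦ret⟧ : ∀ V e ς → fun (⟦ ret V ⟧T e) ς ≈C just (⟦ V ⟧V e , ς)
      ⟦⋆⟧ : ∀ M V e ς →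
        fun (⟦ M ⋆ V ⟧T e) ς ≈C bindC (fun (⟦ M ⟧T e) ς) (Φ (⟦ V ⟧V e))
      ⟦get⟧ : ∀ ℓ x M e ς →
        fun (⟦ get ℓ x M ⟧T e) ς ≈C appLift (Φ (⟦ lam x M ⟧V e)) (ς ℓ) ς
      ⟦set⟧ : ∀ ℓ V M e ς →
        fun (⟦ set ℓ V M ⟧T e) ς ≈C fun (⟦ M ⟧T e) (update ς ℓ (just (⟦ V ⟧V e)))

  _⊨_≐_ : Model → Comp → Comp → Set
  𝓜 ⊨ M ≐ N = ∀ (e : Env) (ς : St) → fun (⟦ M ⟧T e) ς ≈C fun (⟦ N ⟧T e) ς
    where open Model 𝓜

-- Sequencing is the strict
-- bind of the state monad, so (2) and (3) are its right unit and
-- associativity laws, and (4), (5) hold because get and set only act on the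
-- state before handing it to the rest of the computation.  Equation (1) is
-- the semantic substitution lemma: ⟦ M[σ] ⟧ e = ⟦ M ⟧ e' whenever
-- ⟦ σ z ⟧ e = e' z for the free variables z of M.  It rests on the
-- coincidence lemma (meaning depends only on free variables), which is also
-- where the side conditions of (3) and (4) are used.  States are functions,
-- so results agree only up to ≈C; that elements of TD and Ψ respect this
-- follows from monotonicity and antisymmetry.
module Submission where

open import Defs
open import Data.Bool using (true; false; T; if_then_else_)
open import Data.List using (List; _∷_; foldr)
open import Data.List.Membership.Propositional using (_∈_; _∉_; lose)
open import Data.List.Membership.Propositional.Properties using (∈-++⁺ˡ; ∈-++⁺ʳ; ∈-filter⁺; ∈-concatMap⁺)
open import Data.List.Relation.Unary.Any using (here; there)
open import Data.Maybe using (just; nothing)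
open import Data.Nat using (_⊔_; _≡ᵇ_; _≤_)
open import Data.Nat.Properties using (≡ᵇ⇒≡; ≡⇒≡ᵇ; m≤m⊔n; m≤n⊔m; ≤-trans; 1+n≰n)
open import Data.Product using (_×_; _,_; proj₁)
open import Data.Unit using (tt)
open import Function using (_∘_)
open import Relation.Binary.Bundles using (Setoid)
open import Relation.Binary.PropositionalEquality using (_≡_; _≢_; refl; sym; trans; cong; subst)
open import Relation.Nullary using (contradiction)
import Relation.Binary.Reasoning.Setoid as SetoidReasoning

∈⇒≤foldr-⊔ : ∀ {n ns} → n ∈ ns → n ≤ foldr _⊔_ 0 ns
∈⇒≤foldr-⊔ {n} (here refl) = m≤m⊔n n _
∈⇒≤foldr-⊔ {ns = m ∷ _} (there n∈ns) = ≤-trans (∈⇒≤foldr-⊔ n∈ns) (m≤n⊔m m _)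

fresh-∉ : ∀ σ {xs z} → z ∈ xs → fresh σ xs ∉ fvV (σ z)
fresh-∉ σ z∈xs y∈σz =
  1+n≰n (∈⇒≤foldr-⊔ (∈-concatMap⁺ (λ z → fvV (σ z)) (lose z∈xs y∈σz)))

∈-remove⁺ : ∀ {x z xs} → z ∈ xs → z ≢ x → z ∈ remove x xs
∈-remove⁺ = ∈-filter⁺ _

≡ᵇ≡false⇒≢ : ∀ m n → (m ≡ᵇ n) ≡ false → m ≢ n
≡ᵇ≡false⇒≢ m n eq m≡n = subst T eq (≡⇒≡ᵇ m n m≡n)

if-≡ᵇ-refl : ∀ {A : Set} x {a b : A} → (if x ≡ᵇ x then a else b) ≡ a
if-≡ᵇ-refl x with x ≡ᵇ x in eq
... | true = refl
... | false = contradiction refl (≡ᵇ≡false⇒≢ x x eq)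

if-≡ᵇ-≢ : ∀ {A : Set} y x {a b : A} → y ≢ x → (if y ≡ᵇ x then a else b) ≡ b
if-≡ᵇ-≢ y x y≢x with y ≡ᵇ x in eq
... | false = refl
... | true = contradiction (≡ᵇ⇒≡ y x (subst T (sym eq) tt)) y≢x

AgreeOn : {A : Set} → List Var → (Var → A) → (Var → A) → Set
AgreeOn xs f g = ∀ {z} → z ∈ xs → f z ≡ g z

module StateMonadProperties (D : Domain) where
  open Domain D

  infix 4 _≈_ _≈T_

  _≈_ : Rel (Cst D)
  _≈_ = _≈C_ D

  _≈T_ : Rel (TD D)
  t ≈T t' = ∀ ς → fun t ς ≈ fun t' ς

  ≈-refl : ∀ {c} → c ≈ c
  ≈-refl {nothing} = tt
  ≈-refl {just _} = refl , λ _ → refl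

  ≈-sym : ∀ {c c'} → c ≈ c' → c' ≈ c
  ≈-sym {nothing} {nothing} _ = tt
  ≈-sym {just _} {just _} (p , q) = sym p , sym ∘ q

  ≈-trans : ∀ {c c' c''} → c ≈ c' → c' ≈ c'' → c ≈ c''
  ≈-trans {nothing} {nothing} {nothing} _ _ = tt
  ≈-trans {just _} {just _} {just _} (p , q) (p' , q') = trans p p' , λ ℓ → trans (q ℓ) (q' ℓ)

  ≈-setoid : Setoid _ _
  ≈-setoid = record
    { Carrier = Cst D
    ; _≈_ = _≈_
    ; isEquivalence = record { refl = ≈-refl ; sym = ≈-sym ; trans = ≈-trans }
    }

  ≡⇒⊑⊥ : ∀ {m m'} → m ≡ m' → LiftR _⊑_ m m'
  ≡⇒⊑⊥ {nothing} refl = ⊥≤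
  ≡⇒⊑⊥ {just _} refl = up≤ ⊑-refl

  ⊑⊥-antisym : ∀ {m m'} → LiftR _⊑_ m m' → LiftR _⊑_ m' m → m ≡ m'
  ⊑⊥-antisym ⊥≤ ⊥≤ = refl
  ⊑⊥-antisym (up≤ p) (up≤ q) = cong just (⊑-antisym p q)

  ≈⇒⊑C : ∀ {c c'} → c ≈ c' → _⊑C_ D c c'
  ≈⇒⊑C {nothing} {nothing} _ = ⊥≤
  ≈⇒⊑C {just _} {just _} (refl , q) = up≤ (⊑-refl , ≡⇒⊑⊥ ∘ q)

  ⊑C-antisym : ∀ {c c'} → _⊑C_ D c c' → _⊑C_ D c' c → c ≈ c'
  ⊑C-antisym ⊥≤ ⊥≤ = tt
  ⊑C-antisym (up≤ (p , p')) (up≤ (q , q')) = ⊑-antisym p q , λ ℓ → ⊑⊥-antisym (p' ℓ) (q' ℓ)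

  fun-cong : ∀ (t : TD D) {ς ς'} → (∀ ℓ → ς ℓ ≡ ς' ℓ) → fun t ς ≈ fun t ς'
  fun-cong t eq = ⊑C-antisym (monotone (≡⇒⊑⊥ ∘ eq)) (monotone (≡⇒⊑⊥ ∘ sym ∘ eq))
    where monotone = proj₁ (cont t)

  bindC-cong : ∀ {c c' F} → c ≈ c' → bindC D c F ≈ bindC D c' F
  bindC-cong {nothing} {nothing} _ = tt
  bindC-cong {just (d , ς)} {just (_ , ς')} {F} (refl , eq) = fun-cong (app F d) eq

  bindC-identityʳ : ∀ c {F} → (∀ d ς → fun (app F d) ς ≈ just (d , ς)) → bindC D c F ≈ c
  bindC-identityʳ nothing _ = tt
  bindC-identityʳ (just (d , ς)) F-returns = F-returns d ς

  bindC-assoc : ∀ c {F G H} → (∀ d ς → bindC D (fun (app F d) ς) G ≈ fun (app H d) ς) →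
                bindC D (bindC D c F) G ≈ bindC D c H
  bindC-assoc nothing _ = tt
  bindC-assoc (just (d , ς)) F⋆G≈H = F⋆G≈H d ς

  bindC-appLift : ∀ v ς {F G H} → (∀ d → bindC D (fun (app F d) ς) G ≈ fun (app H d) ς) →
                  bindC D (appLift D F v ς) G ≈ appLift D H v ς
  bindC-appLift nothing _ _ = tt
  bindC-appLift (just d) _ F⋆G≈H = F⋆G≈H d

module Semantics (D : Domain) (𝓜 : Model D) where
  open Domain D
  open Model 𝓜
  open StateMonadProperties D
  open SetoidReasoning ≈-setoid

  infixl 6 _[_↦_]
  _[_↦_] : Env D → Var → Carrier → Env D
  _[_↦_] = _[_↦_]e D

  Ψ-cong : ∀ {f g} → (∀ d → app f d ≈T app g d) → Ψ f ≡ Ψ g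
  Ψ-cong f≈g = ⊑-antisym (proj₁ Ψ-cont (λ d ς → ≈⇒⊑C (f≈g d ς)))
                         (proj₁ Ψ-cont (λ d ς → ≈⇒⊑C (≈-sym (f≈g d ς))))

  Φ⟦lam⟧ : ∀ x M e d → app (Φ (⟦ lam x M ⟧V e)) d ≈T ⟦ M ⟧T (e [ x ↦ d ])
  Φ⟦lam⟧ x M e d ς rewrite ⟦lam⟧ x M e = ΦΨ _ d ς

  ⟦lam⟧-cong : ∀ {x M x' M' e e'} → (∀ d → ⟦ M ⟧T (e [ x ↦ d ]) ≈T ⟦ M' ⟧T (e' [ x' ↦ d ])) →
               ⟦ lam x M ⟧V e ≡ ⟦ lam x' M' ⟧V e'
  ⟦lam⟧-cong {x} {M} {x'} {M'} {e} {e'} M≈M' =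
    trans (⟦lam⟧ x M e) (trans (Ψ-cong M≈M') (sym (⟦lam⟧ x' M' e')))

  ⟦ret⟧-cong : ∀ {V V' e e'} → ⟦ V ⟧V e ≡ ⟦ V' ⟧V e' → ⟦ ret V ⟧T e ≈T ⟦ ret V' ⟧T e'
  ⟦ret⟧-cong {V} {V'} {e} {e'} V≡V' ς = begin
    fun (⟦ ret V ⟧T e) ς    ≈⟨ ⟦ret⟧ V e ς ⟩
    just (⟦ V ⟧V e , ς)     ≡⟨ cong (λ v → just (v , ς)) V≡V' ⟩
    just (⟦ V' ⟧V e' , ς)   ≈⟨ ⟦ret⟧ V' e' ς ⟨
    fun (⟦ ret V' ⟧T e') ς  ∎

  ⟦⋆⟧-cong : ∀ {M V M' V' e e'} → ⟦ M ⟧T e ≈T ⟦ M' ⟧T e' → ⟦ V ⟧V e ≡ ⟦ V' ⟧V e' →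
             ⟦ M ⋆ V ⟧T e ≈T ⟦ M' ⋆ V' ⟧T e'
  ⟦⋆⟧-cong {M} {V} {M'} {V'} {e} {e'} M≈M' V≡V' ς = begin
    fun (⟦ M ⋆ V ⟧T e) ς                         ≈⟨ ⟦⋆⟧ M V e ς ⟩
    bindC D (fun (⟦ M ⟧T e) ς) (Φ (⟦ V ⟧V e))     ≈⟨ bindC-cong (M≈M' ς) ⟩
    bindC D (fun (⟦ M' ⟧T e') ς) (Φ (⟦ V ⟧V e))   ≡⟨ cong (bindC D (fun (⟦ M' ⟧T e') ς) ∘ Φ) V≡V' ⟩
    bindC D (fun (⟦ M' ⟧T e') ς) (Φ (⟦ V' ⟧V e')) ≈⟨ ⟦⋆⟧ M' V' e' ς ⟨
    fun (⟦ M' ⋆ V' ⟧T e') ς                       ∎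

  ⟦get⟧-cong : ∀ {ℓ x M x' M' e e'} → ⟦ lam x M ⟧V e ≡ ⟦ lam x' M' ⟧V e' →
               ⟦ get ℓ x M ⟧T e ≈T ⟦ get ℓ x' M' ⟧T e'
  ⟦get⟧-cong {ℓ} {x} {M} {x'} {M'} {e} {e'} λM≡λM' ς = begin
    fun (⟦ get ℓ x M ⟧T e) ς                  ≈⟨ ⟦get⟧ ℓ x M e ς ⟩
    appLift D (Φ (⟦ lam x M ⟧V e)) (ς ℓ) ς     ≡⟨ cong (λ v → appLift D (Φ v) (ς ℓ) ς) λM≡λM' ⟩
    appLift D (Φ (⟦ lam x' M' ⟧V e')) (ς ℓ) ς  ≈⟨ ⟦get⟧ ℓ x' M' e' ς ⟨
    fun (⟦ get ℓ x' M' ⟧T e') ς                ∎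

  ⟦set⟧-cong : ∀ {ℓ V M V' M' e e'} → ⟦ V ⟧V e ≡ ⟦ V' ⟧V e' → ⟦ M ⟧T e ≈T ⟦ M' ⟧T e' →
               ⟦ set ℓ V M ⟧T e ≈T ⟦ set ℓ V' M' ⟧T e'
  ⟦set⟧-cong {ℓ} {V} {M} {V'} {M'} {e} {e'} V≡V' M≈M' ς = begin
    fun (⟦ set ℓ V M ⟧T e) ς                                  ≈⟨ ⟦set⟧ ℓ V M e ς ⟩
    fun (⟦ M ⟧T e) (update D ς ℓ (just (⟦ V ⟧V e)))            ≈⟨ M≈M' _ ⟩
    fun (⟦ M' ⟧T e') (update D ς ℓ (just (⟦ V ⟧V e)))
      ≡⟨ cong (λ v → fun (⟦ M' ⟧T e') (update D ς ℓ (just v))) V≡V' ⟩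
    fun (⟦ M' ⟧T e') (update D ς ℓ (just (⟦ V' ⟧V e')))        ≈⟨ ⟦set⟧ ℓ V' M' e' ς ⟨
    fun (⟦ set ℓ V' M' ⟧T e') ς                                ∎

  AgreeOn-update : ∀ {x xs e e' d} → AgreeOn (remove x xs) e e' →
                   AgreeOn xs (e [ x ↦ d ]) (e' [ x ↦ d ])
  AgreeOn-update {x} e≡e' {z} z∈xs with z ≡ᵇ x in eq
  ... | true = refl
  ... | false = e≡e' (∈-remove⁺ z∈xs (≡ᵇ≡false⇒≢ z x eq))

  mutual
    ⟦⟧V-coincidence : ∀ V {e e'} → AgreeOn (fvV V) e e' → ⟦ V ⟧V e ≡ ⟦ V ⟧V e'
    ⟦⟧V-coincidence (var x) {e} {e'} e≡e' =
      trans (⟦var⟧ x e) (trans (e≡e' (here refl)) (sym (⟦var⟧ x e')))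
    ⟦⟧V-coincidence (lam x M) e≡e' = ⟦lam⟧-cong λ _ → ⟦⟧T-coincidence M (AgreeOn-update e≡e')

    ⟦⟧T-coincidence : ∀ M {e e'} → AgreeOn (fvC M) e e' → ⟦ M ⟧T e ≈T ⟦ M ⟧T e'
    ⟦⟧T-coincidence (ret V) e≡e' = ⟦ret⟧-cong (⟦⟧V-coincidence V e≡e')
    ⟦⟧T-coincidence (M ⋆ V) e≡e' =
      ⟦⋆⟧-cong (⟦⟧T-coincidence M (e≡e' ∘ ∈-++⁺ˡ)) (⟦⟧V-coincidence V (e≡e' ∘ ∈-++⁺ʳ (fvC M)))
    ⟦⟧T-coincidence (get ℓ x M) e≡e' =
      ⟦get⟧-cong (⟦lam⟧-cong λ _ → ⟦⟧T-coincidence M (AgreeOn-update e≡e'))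
    ⟦⟧T-coincidence (set ℓ V M) e≡e' =
      ⟦set⟧-cong (⟦⟧V-coincidence V (e≡e' ∘ ∈-++⁺ˡ)) (⟦⟧T-coincidence M (e≡e' ∘ ∈-++⁺ʳ (fvV V)))

  ⟦⟧V-update-∉ : ∀ V {x e d} → x ∉ fvV V → ⟦ V ⟧V (e [ x ↦ d ]) ≡ ⟦ V ⟧V e
  ⟦⟧V-update-∉ V {x} x∉V = ⟦⟧V-coincidence V λ {z} z∈V → if-≡ᵇ-≢ z x λ { refl → x∉V z∈V }

  AgreeOn-extend : ∀ {σ x y xs e e' d} → (∀ {z} → z ∈ remove x xs → y ∉ fvV (σ z)) →
                   AgreeOn (remove x xs) (λ z → ⟦ σ z ⟧V e) e' →
                   AgreeOn xs (λ z → ⟦ extend σ x (var y) z ⟧V (e [ y ↦ d ])) (e' [ x ↦ d ])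
  AgreeOn-extend {σ} {x} {y} y-fresh σ≡e' {z} z∈xs with z ≡ᵇ x in eq
  ... | true = trans (⟦var⟧ y _) (if-≡ᵇ-refl y)
  ... | false = trans (⟦⟧V-update-∉ (σ z) (y-fresh z∈xs')) (σ≡e' z∈xs')
    where z∈xs' = ∈-remove⁺ z∈xs (≡ᵇ≡false⇒≢ z x eq)

  mutual
    ⟦⟧V-subst : ∀ V σ {e e'} → AgreeOn (fvV V) (λ z → ⟦ σ z ⟧V e) e' → ⟦ substV σ V ⟧V e ≡ ⟦ V ⟧V e'
    ⟦⟧V-subst (var x) σ {e' = e'} σ≡e' = trans (σ≡e' (here refl)) (sym (⟦var⟧ x e'))
    ⟦⟧V-subst (lam x M) σ σ≡e' = ⟦lam⟧-cong λ _ → ⟦⟧T-subst M _ (AgreeOn-extend (fresh-∉ σ) σ≡e')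

    ⟦⟧T-subst : ∀ M σ {e e'} → AgreeOn (fvC M) (λ z → ⟦ σ z ⟧V e) e' → ⟦ substC σ M ⟧T e ≈T ⟦ M ⟧T e'
    ⟦⟧T-subst (ret V) σ σ≡e' = ⟦ret⟧-cong (⟦⟧V-subst V σ σ≡e')
    ⟦⟧T-subst (M ⋆ V) σ σ≡e' =
      ⟦⋆⟧-cong (⟦⟧T-subst M σ (σ≡e' ∘ ∈-++⁺ˡ)) (⟦⟧V-subst V σ (σ≡e' ∘ ∈-++⁺ʳ (fvC M)))
    ⟦⟧T-subst (get ℓ x M) σ σ≡e' =
      ⟦get⟧-cong (⟦lam⟧-cong λ _ → ⟦⟧T-subst M _ (AgreeOn-extend (fresh-∉ σ) σ≡e'))
    ⟦⟧T-subst (set ℓ V M) σ σ≡e' =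
      ⟦set⟧-cong (⟦⟧V-subst V σ (σ≡e' ∘ ∈-++⁺ˡ)) (⟦⟧T-subst M σ (σ≡e' ∘ ∈-++⁺ʳ (fvV V)))

  Φ⟦lam⟧-⋆ : ∀ x M W e d ς → x ∉ fvV W →
             bindC D (fun (app (Φ (⟦ lam x M ⟧V e)) d) ς) (Φ (⟦ W ⟧V e))
               ≈ fun (app (Φ (⟦ lam x (M ⋆ W) ⟧V e)) d) ς
  Φ⟦lam⟧-⋆ x M W e d ς x∉W = begin
    bindC D (fun (app (Φ (⟦ lam x M ⟧V e)) d) ς) (Φ (⟦ W ⟧V e))  ≈⟨ bindC-cong (Φ⟦lam⟧ x M e d ς) ⟩
    bindC D (fun (⟦ M ⟧T e') ς) (Φ (⟦ W ⟧V e))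
      ≡⟨ cong (bindC D (fun (⟦ M ⟧T e') ς) ∘ Φ) (⟦⟧V-update-∉ W x∉W) ⟨
    bindC D (fun (⟦ M ⟧T e') ς) (Φ (⟦ W ⟧V e'))                  ≈⟨ ⟦⋆⟧ M W e' ς ⟨
    fun (⟦ M ⋆ W ⟧T e') ς                                         ≈⟨ Φ⟦lam⟧ x (M ⋆ W) e d ς ⟨
    fun (app (Φ (⟦ lam x (M ⋆ W) ⟧V e)) d) ς                      ∎
    where e' = e [ x ↦ d ]

  infix 4 _≐_
  _≐_ : Comp → Comp → Set
  _≐_ = _⊨_≐_ D 𝓜

  ⊨-β : ∀ V x M → ret V ⋆ lam x M ≐ M [ V / x ]
  ⊨-β V x M e ς = begin
    fun (⟦ ret V ⋆ lam x M ⟧T e) ς                       ≈⟨ ⟦⋆⟧ (ret V) (lam x M) e ς ⟩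
    bindC D (fun (⟦ ret V ⟧T e) ς) (Φ (⟦ lam x M ⟧V e))  ≈⟨ bindC-cong (⟦ret⟧ V e ς) ⟩
    fun (app (Φ (⟦ lam x M ⟧V e)) (⟦ V ⟧V e)) ς          ≈⟨ Φ⟦lam⟧ x M e (⟦ V ⟧V e) ς ⟩
    fun (⟦ M ⟧T (e [ x ↦ ⟦ V ⟧V e ])) ς                  ≈⟨ ⟦⟧T-subst M (extend var x V) V/x≡x↦V ς ⟨
    fun (⟦ M [ V / x ] ⟧T e) ς                           ∎
    where
    V/x≡x↦V : AgreeOn (fvC M) (λ z → ⟦ extend var x V z ⟧V e) (e [ x ↦ ⟦ V ⟧V e ])
    V/x≡x↦V {z} _ with z ≡ᵇ x
    ... | true = refl
    ... | false = ⟦var⟧ z e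

  ⊨-η : ∀ M x → M ⋆ lam x (ret (var x)) ≐ M
  ⊨-η M x e ς = begin
    fun (⟦ M ⋆ lam x (ret (var x)) ⟧T e) ς                            ≈⟨ ⟦⋆⟧ M _ e ς ⟩
    bindC D (fun (⟦ M ⟧T e) ς) (Φ (⟦ lam x (ret (var x)) ⟧V e))       ≈⟨ bindC-identityʳ _ returns ⟩
    fun (⟦ M ⟧T e) ς                                                  ∎
    where
    returns : ∀ d ς → fun (app (Φ (⟦ lam x (ret (var x)) ⟧V e)) d) ς ≈ just (d , ς)
    returns d ς = begin
      fun (app (Φ (⟦ lam x (ret (var x)) ⟧V e)) d) ς  ≈⟨ Φ⟦lam⟧ x _ e d ς ⟩
      fun (⟦ ret (var x) ⟧T (e [ x ↦ d ])) ς          ≈⟨ ⟦ret⟧ (var x) _ ς ⟩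
      just (⟦ var x ⟧V (e [ x ↦ d ]) , ς)
        ≡⟨ cong (λ v → just (v , ς)) (trans (⟦var⟧ x _) (if-≡ᵇ-refl x)) ⟩
      just (d , ς)                                    ∎

  ⊨-assoc : ∀ L M N x y → x ∉ fvV (lam y N) →
            (L ⋆ lam x M) ⋆ lam y N ≐ L ⋆ lam x (M ⋆ lam y N)
  ⊨-assoc L M N x y x∉λN e ς = begin
    fun (⟦ (L ⋆ lam x M) ⋆ lam y N ⟧T e) ς                        ≈⟨ ⟦⋆⟧ (L ⋆ lam x M) (lam y N) e ς ⟩
    bindC D (fun (⟦ L ⋆ lam x M ⟧T e) ς) (Φ (⟦ lam y N ⟧V e))     ≈⟨ bindC-cong (⟦⋆⟧ L (lam x M) e ς) ⟩
    bindC D (bindC D (fun (⟦ L ⟧T e) ς) (Φ (⟦ lam x M ⟧V e))) (Φ (⟦ lam y N ⟧V e))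
      ≈⟨ bindC-assoc (fun (⟦ L ⟧T e) ς) (λ d ς' → Φ⟦lam⟧-⋆ x M (lam y N) e d ς' x∉λN) ⟩
    bindC D (fun (⟦ L ⟧T e) ς) (Φ (⟦ lam x (M ⋆ lam y N) ⟧V e))   ≈⟨ ⟦⋆⟧ L _ e ς ⟨
    fun (⟦ L ⋆ lam x (M ⋆ lam y N) ⟧T e) ς                        ∎

  ⊨-get-⋆ : ∀ ℓ x M W → x ∉ fvV W → get ℓ x M ⋆ W ≐ get ℓ x (M ⋆ W)
  ⊨-get-⋆ ℓ x M W x∉W e ς = begin
    fun (⟦ get ℓ x M ⋆ W ⟧T e) ς                                     ≈⟨ ⟦⋆⟧ (get ℓ x M) W e ς ⟩
    bindC D (fun (⟦ get ℓ x M ⟧T e) ς) (Φ (⟦ W ⟧V e))                ≈⟨ bindC-cong (⟦get⟧ ℓ x M e ς) ⟩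
    bindC D (appLift D (Φ (⟦ lam x M ⟧V e)) (ς ℓ) ς) (Φ (⟦ W ⟧V e))
      ≈⟨ bindC-appLift (ς ℓ) ς (λ d → Φ⟦lam⟧-⋆ x M W e d ς x∉W) ⟩
    appLift D (Φ (⟦ lam x (M ⋆ W) ⟧V e)) (ς ℓ) ς                     ≈⟨ ⟦get⟧ ℓ x (M ⋆ W) e ς ⟨
    fun (⟦ get ℓ x (M ⋆ W) ⟧T e) ς                                   ∎

  ⊨-set-⋆ : ∀ ℓ V M W → set ℓ V M ⋆ W ≐ set ℓ V (M ⋆ W)
  ⊨-set-⋆ ℓ V M W e ς = begin
    fun (⟦ set ℓ V M ⋆ W ⟧T e) ς                       ≈⟨ ⟦⋆⟧ (set ℓ V M) W e ς ⟩
    bindC D (fun (⟦ set ℓ V M ⟧T e) ς) (Φ (⟦ W ⟧V e))  ≈⟨ bindC-cong (⟦set⟧ ℓ V M e ς) ⟩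
    bindC D (fun (⟦ M ⟧T e) ς') (Φ (⟦ W ⟧V e))         ≈⟨ ⟦⋆⟧ M W e ς' ⟨
    fun (⟦ M ⋆ W ⟧T e) ς'                              ≈⟨ ⟦set⟧ ℓ V (M ⋆ W) e ς ⟨
    fun (⟦ set ℓ V (M ⋆ W) ⟧T e) ς                     ∎
    where ς' = update D ς ℓ (just (⟦ V ⟧V e))

mainTheorem13 : (D : Domain) (𝓜 : Model D) →
    (∀ (V : Val) (x : Var) (M : Comp) → _⊨_≐_ D 𝓜 (ret V ⋆ lam x M) (M [ V / x ]))
    × (∀ (M : Comp) (x : Var) → _⊨_≐_ D 𝓜 (M ⋆ lam x (ret (var x))) M)
    × (∀ (L M N : Comp) (x y : Var) → x ∉ fvV (lam y N) →
        _⊨_≐_ D 𝓜 ((L ⋆ lam x M) ⋆ lam y N) (L ⋆ lam x (M ⋆ lam y N)))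
    × (∀ (ℓ : Loc) (x : Var) (M : Comp) (W : Val) → x ∉ fvV W →
        _⊨_≐_ D 𝓜 (get ℓ x M ⋆ W) (get ℓ x (M ⋆ W)))
    × (∀ (ℓ : Loc) (V : Val) (M : Comp) (W : Val) →
        _⊨_≐_ D 𝓜 (set ℓ V M ⋆ W) (set ℓ V (M ⋆ W)))
mainTheorem13 D 𝓜 = ⊨-β , ⊨-η , ⊨-assoc , ⊨-get-⋆ , ⊨-set-⋆
  where open Semantics D 𝓜
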